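{- Let $\beta=2+3i\in\mathbb Z[i]$ and for a positive integer $Z$ put \[ a(Z)=\tfrac12\bigl|\beta^Z+(-\bar\beta)^Z\bigr|,\qquad b(Z)=\tfrac12\bigl|\beta^Z-(-\bar\beta)^Z\bigr|. \] Then $a(Z),b(Z)$ are integers coprime to $13$ and \[ \bigl(e_{13}(a(Z)),e_{13}(b(Z))\bigr)=\begin{cases}(3,6)&\text{if }Z\equiv1,3\pmod 6,\\(2,1)&\text{if }Z\equiv2\pmod6,\\(6,3)&\text{if }Z\equiv0,4\pmod6,\\(1,2)&\text{if }Z\equiv5\pmod6.\end{cases} \]
   Context: For a positive integer $M$ and an integer $A$ coprime to $M$, $e_M(A)$ is the least positive integer $e$ with $A^e\equiv\pm1\pmod M$. -}

module Defs where

open import Data.Nat as ℕ using (ℕ; zero; suc)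
open import Data.Integer as ℤ using (ℤ; +_)
open import Data.Integer.Divisibility using () renaming (_∣_ to _∣ℤ_)
open import Data.Product using (_×_; _,_)
open import Data.Sum using (_⊎_)
open import Relation.Nullary using (¬_)

record ℤ[i] : Set where
  constructor _+_i
  field
    re : ℤ
    im : ℤ
open ℤ[i] public

infixl 6 _⊕_
infixl 7 _⊗_

_⊕_ : ℤ[i] → ℤ[i] → ℤ[i]
(a + b i) ⊕ (c + d i) = (a ℤ.+ c) + (b ℤ.+ d) i

_⊖_ : ℤ[i] → ℤ[i] → ℤ[i]
(a + b i) ⊖ (c + d i) = (a ℤ.- c) + (b ℤ.- d) i

_⊗_ : ℤ[i] → ℤ[i] → ℤ[i]
(a + b i) ⊗ (c + d i) = (a ℤ.* c ℤ.- b ℤ.* d) + (a ℤ.* d ℤ.+ b ℤ.* c) i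

neg : ℤ[i] → ℤ[i]
neg (a + b i) = (ℤ.- a) + (ℤ.- b) i

conj : ℤ[i] → ℤ[i]
conj (a + b i) = a + (ℤ.- b) i

_^ᵍ_ : ℤ[i] → ℕ → ℤ[i]
z ^ᵍ zero = (+ 1) + (+ 0) i
z ^ᵍ suc n = z ⊗ (z ^ᵍ n)

norm : ℤ[i] → ℤ
norm (a + b i) = a ℤ.* a ℤ.+ b ℤ.* b

β : ℤ[i]
β = (+ 2) + (+ 3) i

sumZ : ℕ → ℤ[i]
sumZ Z = (β ^ᵍ Z) ⊕ (neg (conj β) ^ᵍ Z)

diffZ : ℕ → ℤ[i]
diffZ Z = (β ^ᵍ Z) ⊖ (neg (conj β) ^ᵍ Z)

-- "a is the number ½|w|" for a natural number a ≥ 0: |w| = 2a, i.e. N(w) = (2a)^2.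
IsHalfAbs : ℤ[i] → ℕ → Set
IsHalfAbs w a = norm w ≡ℤ (+ (2 ℕ.* a)) ℤ.* (+ (2 ℕ.* a))
  where
  open import Relation.Binary.PropositionalEquality using () renaming (_≡_ to _≡ℤ_)

PowPM1 : ℕ → ℤ → ℕ → Set
PowPM1 M A e = ((+ M) ∣ℤ (A ℤ.^ e ℤ.- + 1)) ⊎ ((+ M) ∣ℤ (A ℤ.^ e ℤ.+ + 1))

-- IsE M A e  :⇔  e = e_M(A), the least positive e with A^e ≡ ±1 (mod M).
IsE : ℕ → ℤ → ℕ → Set
IsE M A e = (0 ℕ.< e) × PowPM1 M A e × (∀ e′ → 0 ℕ.< e′ → e′ ℕ.< e → ¬ PowPM1 M A e′)

expected : ℕ → ℕ × ℕ
expected 0 = 6 , 3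
expected 1 = 3 , 6
expected 2 = 2 , 1
expected 3 = 3 , 6
expected 4 = 6 , 3
expected _ = 1 , 2

{-# OPTIONS --safe #-}
-- Put w = β^Z. Since (-β̄)^Z = (-1)^Z w̄, the numbers β^Z ± (-β̄)^Z are 2 Re w and
-- 2i Im w, in an order fixed by the parity of Z; so {a(Z), b(Z)} = {|Re w|, |Im w|}.
-- Whether A^e ≡ ±1 (mod 13) depends only on ±A mod 13, and it already forces A to be
-- prime to 13. Finally β^7 ≡ β (mod 13), so for Z ≥ 1 both β^Z mod 13 and (-1)^Z depend
-- only on Z mod 6, and the six cases Z = 1, …, 6 are settled by computation.
module Submission where

open import Defs
open import Data.Nat as ℕ using (ℕ; zero; suc; _<_; _%_; s≤s; s≤s⁻¹)
open import Data.Nat.Properties using (m≤n⇒m<n∨m≡n; allUpTo?; _<?_)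
open import Data.Nat.DivMod using (m<n⇒m%n≡m; n%n≡0; m%n<n; m%n%n≡m%n; %-distribˡ-+)
open import Data.Nat.Divisibility using (_∣_; _∣?_; ∣1⇒≡1; ∣m⇒∣m*n)
open import Data.Nat.Coprimality using (Coprime)
open import Data.Integer as ℤ using (ℤ; +_; -_; _*_; _-_; _^_; ∣_∣; -1ℤ; 1ℤ)
open import Data.Integer.Properties using (+∣i∣≡i⊎+∣i∣≡-i; abs-*; +-identityʳ; +-identityˡ; +-inverseʳ; neg-distribˡ-*; neg-involutive)
open import Data.Integer.Divisibility.Signed as Signed using (divides; ∣ᵤ⇒∣; ∣⇒∣ᵤ; ∣m∣n⇒∣m+n; ∣n⇒∣m*n; ∣m⇒∣-m; ∣m+n∣m⇒∣n)
open import Data.Integer.Tactic.RingSolver using (solve-∀)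
open import Data.Product using (_×_; _,_; ∃₂; proj₁; proj₂)
open import Data.Sum as Sum using (_⊎_; inj₁; inj₂)
open import Function using (_∘_)
open import Level using (0ℓ)
open import Relation.Binary.Core using (Rel)
open import Relation.Binary.Definitions using (Reflexive; Transitive)
open import Relation.Binary.PropositionalEquality
open import Relation.Nullary using (Dec; ¬?)
open import Relation.Nullary.Decidable using (True; toWitness; map′; _×-dec_; _⊎-dec_; _→-dec_)

suc-% : ∀ n p .{{_ : ℕ.NonZero p}} → suc n % p ≡ suc (n % p) % p
suc-% n p = begin
  (1 ℕ.+ n) % p               ≡⟨ %-distribˡ-+ 1 n p ⟩
  (1 % p ℕ.+ n % p) % p       ≡⟨ cong (λ k → (1 % p ℕ.+ k) % p) (m%n%n≡m%n n p) ⟨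
  (1 % p ℕ.+ n % p % p) % p   ≡⟨ %-distribˡ-+ 1 (n % p) p ⟨
  (1 ℕ.+ n % p) % p           ∎
  where open ≡-Reasoning

module _ {A : Set} (_≈_ : Rel A 0ℓ) (≈-refl : Reflexive _≈_) (≈-trans : Transitive _≈_) where

  %-periodic : (u : ℕ → A) (k : ℕ) → (∀ {m n} → u m ≈ u n → u (suc m) ≈ u (suc n)) →
               u (suc k) ≈ u 0 → ∀ n → u n ≈ u (n % suc k)
  %-periodic u k u-cong period = periodic
    where
    wrap : ∀ {r} → r < suc k → u (suc r) ≈ u (suc r % suc k)
    wrap r<p with m≤n⇒m<n∨m≡n (s≤s⁻¹ r<p)
    ... | inj₁ r<k rewrite m<n⇒m%n≡m (s≤s r<k) = ≈-refl
    ... | inj₂ refl rewrite n%n≡0 (suc k) ⦃ _ ⦄ = period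

    periodic : ∀ n → u n ≈ u (n % suc k)
    periodic zero = ≈-refl
    periodic (suc n) rewrite suc-% n (suc k) ⦃ _ ⦄ =
      ≈-trans (u-cong (periodic n)) (wrap (m%n<n n (suc k)))

infix 4 _≡_[mod_] _≡±1[mod_] _≡ᵍ_[mod_]

-- A record rather than a definition by the divisibility, so that x, y and M
-- can be inferred from a proof.
record _≡_[mod_] (x y : ℤ) (M : ℕ) : Set where
  constructor ≡mod
  field ∣-difference : + M Signed.∣ x - y
open _≡_[mod_]

module _ {M : ℕ} where

  ≡mod-refl : ∀ {x} → x ≡ x [mod M ]
  ≡mod-refl {x} = ≡mod (subst (+ M Signed.∣_) (sym (+-inverseʳ x)) (divides (+ 0) refl))

  ≡mod-sym : ∀ {x y} → x ≡ y [mod M ] → y ≡ x [mod M ]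
  ≡mod-sym {x} {y} (≡mod M∣x-y) = ≡mod (subst (+ M Signed.∣_) (identity x y) (∣m⇒∣-m M∣x-y))
    where
    identity : ∀ x y → - (x - y) ≡ y - x
    identity = solve-∀

  ≡mod-trans : ∀ {x y z} → x ≡ y [mod M ] → y ≡ z [mod M ] → x ≡ z [mod M ]
  ≡mod-trans {x} {y} {z} (≡mod M∣x-y) (≡mod M∣y-z) =
    ≡mod (subst (+ M Signed.∣_) (identity x y z) (∣m∣n⇒∣m+n M∣x-y M∣y-z))
    where
    identity : ∀ x y z → (x - y) ℤ.+ (y - z) ≡ x - z
    identity = solve-∀

  ≡mod-neg : ∀ {x y} → x ≡ y [mod M ] → - x ≡ - y [mod M ]
  ≡mod-neg {x} {y} (≡mod M∣x-y) = ≡mod (subst (+ M Signed.∣_) (identity x y) (∣m⇒∣-m M∣x-y))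
    where
    identity : ∀ x y → - (x - y) ≡ - x - - y
    identity = solve-∀

  ≡mod-+ : ∀ {x x′ y y′} → x ≡ x′ [mod M ] → y ≡ y′ [mod M ] → x ℤ.+ y ≡ x′ ℤ.+ y′ [mod M ]
  ≡mod-+ {x} {x′} {y} {y′} (≡mod M∣x-x′) (≡mod M∣y-y′) =
    ≡mod (subst (+ M Signed.∣_) (identity x x′ y y′) (∣m∣n⇒∣m+n M∣x-x′ M∣y-y′))
    where
    identity : ∀ x x′ y y′ → (x - x′) ℤ.+ (y - y′) ≡ (x ℤ.+ y) - (x′ ℤ.+ y′)
    identity = solve-∀

  ≡mod-* : ∀ {x x′ y y′} → x ≡ x′ [mod M ] → y ≡ y′ [mod M ] → x * y ≡ x′ * y′ [mod M ]
  ≡mod-* {x} {x′} {y} {y′} (≡mod M∣x-x′) (≡mod M∣y-y′) =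
    ≡mod (subst (+ M Signed.∣_) (identity x x′ y y′) (∣m∣n⇒∣m+n (∣n⇒∣m*n y M∣x-x′) (∣n⇒∣m*n x′ M∣y-y′)))
    where
    identity : ∀ x x′ y y′ → y * (x - x′) ℤ.+ x′ * (y - y′) ≡ x * y - x′ * y′
    identity = solve-∀

  ≡mod-*ˡ : ∀ k {x y} → x ≡ y [mod M ] → k * x ≡ k * y [mod M ]
  ≡mod-*ˡ k = ≡mod-* (≡mod-refl {k})

  ≡mod-^ : ∀ {x y} n → x ≡ y [mod M ] → x ^ n ≡ y ^ n [mod M ]
  ≡mod-^ zero    x≡y = ≡mod-refl
  ≡mod-^ (suc n) x≡y = ≡mod-* x≡y (≡mod-^ n x≡y)

  ∣-resp-≡mod : ∀ {d x y} → d Signed.∣ + M → x ≡ y [mod M ] → d Signed.∣ x → d Signed.∣ y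
  ∣-resp-≡mod {d} {x} {y} d∣M (≡mod M∣x-y) d∣x =
    subst (d Signed.∣_) (neg-involutive y) (∣m⇒∣-m (∣m+n∣m⇒∣n (Signed.∣-trans d∣M M∣x-y) d∣x))

_≡±1[mod_] : ℤ → ℕ → Set
x ≡±1[mod M ] = x ≡ 1ℤ [mod M ] ⊎ x ≡ -1ℤ [mod M ]

module _ {M : ℕ} where

  ≡±1-resp : ∀ {x y} → x ≡ y [mod M ] → y ≡±1[mod M ] → x ≡±1[mod M ]
  ≡±1-resp x≡y = Sum.map (≡mod-trans x≡y) (≡mod-trans x≡y)

  ≡±1-neg : ∀ {x} → x ≡±1[mod M ] → - x ≡±1[mod M ]
  ≡±1-neg = Sum.swap ∘ Sum.map ≡mod-neg ≡mod-neg

  ≡±1⇒coprime : ∀ {x} → x ≡±1[mod M ] → Coprime ∣ x ∣ M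
  ≡±1⇒coprime {x} x≡±1 {d} (d∣x , d∣M) = ∣1⇒≡1 (d∣±1 x≡±1)
    where
    d∣x′ : + d Signed.∣ x
    d∣x′ = ∣ᵤ⇒∣ d∣x
    d∣M′ : + d Signed.∣ + M
    d∣M′ = ∣ᵤ⇒∣ d∣M
    d∣±1 : x ≡±1[mod M ] → d ∣ 1
    d∣±1 (inj₁ x≡1)  = ∣⇒∣ᵤ (∣-resp-≡mod d∣M′ x≡1 d∣x′)
    d∣±1 (inj₂ x≡-1) = ∣⇒∣ᵤ (∣-resp-≡mod d∣M′ x≡-1 d∣x′)

neg-^ : ∀ x n → (- x) ^ n ≡ x ^ n ⊎ (- x) ^ n ≡ - (x ^ n)
neg-^ x zero = inj₁ refl
neg-^ x (suc n) with neg-^ x n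
... | inj₁ eq = inj₂ (trans (cong (- x *_) eq) (sym (neg-distribˡ-* x (x ^ n))))
... | inj₂ eq = inj₁ (trans (cong (- x *_) eq) (-x*-y≡x*y x (x ^ n)))
  where
  -x*-y≡x*y : ∀ x y → - x * - y ≡ x * y
  -x*-y≡x*y = solve-∀

module _ {M : ℕ} where

  PowPM1⇒≡±1 : ∀ A e → PowPM1 M A e → A ^ e ≡±1[mod M ]
  PowPM1⇒≡±1 A e = Sum.map (≡mod ∘ ∣ᵤ⇒∣) (≡mod ∘ ∣ᵤ⇒∣)

  ≡±1⇒PowPM1 : ∀ A e → A ^ e ≡±1[mod M ] → PowPM1 M A e
  ≡±1⇒PowPM1 A e = Sum.map (∣⇒∣ᵤ ∘ ∣-difference) (∣⇒∣ᵤ ∘ ∣-difference)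

  PowPM1-resp : ∀ {A C} → A ≡ C [mod M ] → ∀ e → PowPM1 M C e → PowPM1 M A e
  PowPM1-resp {A} {C} A≡C e = ≡±1⇒PowPM1 A e ∘ ≡±1-resp (≡mod-^ e A≡C) ∘ PowPM1⇒≡±1 C e

  PowPM1-neg : ∀ A e → PowPM1 M A e → PowPM1 M (- A) e
  PowPM1-neg A e h with neg-^ A e
  ... | inj₁ eq = ≡±1⇒PowPM1 (- A) e (subst (_≡±1[mod M ]) (sym eq) (PowPM1⇒≡±1 A e h))
  ... | inj₂ eq = ≡±1⇒PowPM1 (- A) e (subst (_≡±1[mod M ]) (sym eq) (≡±1-neg (PowPM1⇒≡±1 A e h)))

  IsE-transfer : ∀ {A C e} → (∀ e → PowPM1 M C e → PowPM1 M A e) → (∀ e → PowPM1 M A e → PowPM1 M C e) →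
                 IsE M C e → IsE M A e
  IsE-transfer {e = e} C⇒A A⇒C (0<e , C^e≡±1 , minimal) =
    0<e , C⇒A e C^e≡±1 , λ e′ 0<e′ e′<e → minimal e′ 0<e′ e′<e ∘ A⇒C e′

  IsE-resp : ∀ {A C e} → A ≡ C [mod M ] → IsE M C e → IsE M A e
  IsE-resp A≡C = IsE-transfer (PowPM1-resp A≡C) (PowPM1-resp (≡mod-sym A≡C))

  IsE-neg : ∀ {A e} → IsE M A e → IsE M (- A) e
  IsE-neg {A} = IsE-transfer { - A} {A} (PowPM1-neg A)
    (λ e → subst (λ B → PowPM1 M B e) (neg-involutive A) ∘ PowPM1-neg (- A) e)

  IsE-∣∣ : ∀ {A e} → IsE M A e → IsE M (+ ∣ A ∣) e
  IsE-∣∣ {A} {e} h with +∣i∣≡i⊎+∣i∣≡-i A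
  ... | inj₁ eq = subst (λ B → IsE M B e) (sym eq) h
  ... | inj₂ eq = subst (λ B → IsE M B e) (sym eq) (IsE-neg {A} h)

  IsE⇒coprime : ∀ {A e} → IsE M A e → Coprime ∣ A ∣ M
  IsE⇒coprime {A} {suc e} (_ , A^e≡±1 , _) {d} (d∣A , d∣M) =
    ≡±1⇒coprime (PowPM1⇒≡±1 A (suc e) A^e≡±1)
                (subst (d ∣_) (sym (abs-* A (A ^ e))) (∣m⇒∣m*n ∣ A ^ e ∣ d∣A) , d∣M)

PowPM1? : ∀ M A e → Dec (PowPM1 M A e)
PowPM1? M A e = (M ∣? ∣ A ^ e - 1ℤ ∣) ⊎-dec (M ∣? ∣ A ^ e ℤ.+ 1ℤ ∣)

IsE? : ∀ M A e → Dec (IsE M A e)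
IsE? M A e = (0 <? e) ×-dec PowPM1? M A e ×-dec map′ from-upTo to-upTo (allUpTo? below? e)
  where
  below? = λ e′ → (0 <? e′) →-dec ¬? (PowPM1? M A e′)
  from-upTo = λ h e′ 0<e′ e′<e → h e′<e 0<e′
  to-upTo = λ h {e′} e′<e 0<e′ → h e′ 0<e′ e′<e

isE-by-computation : ∀ {M A e} {decided : True (IsE? M A e)} → IsE M A e
isE-by-computation {decided = decided} = toWitness decided

_≡ᵍ_[mod_] : ℤ[i] → ℤ[i] → ℕ → Set
z ≡ᵍ w [mod M ] = re z ≡ re w [mod M ] × im z ≡ im w [mod M ]

module _ {M : ℕ} where

  ≡ᵍmod-refl : ∀ {z} → z ≡ᵍ z [mod M ]
  ≡ᵍmod-refl = ≡mod-refl , ≡mod-refl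

  ≡ᵍmod-trans : ∀ {z w v} → z ≡ᵍ w [mod M ] → w ≡ᵍ v [mod M ] → z ≡ᵍ v [mod M ]
  ≡ᵍmod-trans (re₁ , im₁) (re₂ , im₂) = ≡mod-trans re₁ re₂ , ≡mod-trans im₁ im₂

  ⊗-congˡ-mod : ∀ z {w w′} → w ≡ᵍ w′ [mod M ] → z ⊗ w ≡ᵍ z ⊗ w′ [mod M ]
  ⊗-congˡ-mod (a + b i) (re≡ , im≡) =
    ≡mod-+ (≡mod-*ˡ a re≡) (≡mod-neg (≡mod-*ˡ b im≡)) , ≡mod-+ (≡mod-*ˡ a im≡) (≡mod-*ˡ b re≡)

infixr 8 _·_

_·_ : ℤ → ℤ[i] → ℤ[i]
s · (a + b i) = (s * a) + (s * b) i

neg-conj-⊗ : ∀ z w s → neg (conj z) ⊗ s · conj w ≡ (-1ℤ * s) · conj (z ⊗ w)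
neg-conj-⊗ (x + y i) (p + q i) s = cong₂ _+_i (re-identity x y p q s) (im-identity x y p q s)
  where
  re-identity : ∀ x y p q s → (- x) * (s * p) - (- - y) * (s * - q) ≡ (-1ℤ * s) * (x * p - y * q)
  re-identity = solve-∀
  im-identity : ∀ x y p q s → (- x) * (s * - q) ℤ.+ (- - y) * (s * p) ≡ (-1ℤ * s) * - (x * q ℤ.+ y * p)
  im-identity = solve-∀

neg-conj-^ : ∀ z n → neg (conj z) ^ᵍ n ≡ (-1ℤ ^ n) · conj (z ^ᵍ n)
neg-conj-^ z zero    = refl
neg-conj-^ z (suc n) = trans (cong (neg (conj z) ⊗_) (neg-conj-^ z n)) (neg-conj-⊗ z (z ^ᵍ n) (-1ℤ ^ n))

⊕-·conj : ∀ s w → w ⊕ s · conj w ≡ ((1ℤ ℤ.+ s) * re w) + ((1ℤ - s) * im w) i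
⊕-·conj s (p + q i) = cong₂ _+_i (re-identity s p) (im-identity s q)
  where
  re-identity : ∀ s p → p ℤ.+ s * p ≡ (1ℤ ℤ.+ s) * p
  re-identity = solve-∀
  im-identity : ∀ s q → q ℤ.+ s * - q ≡ (1ℤ - s) * q
  im-identity = solve-∀

⊖-·conj : ∀ s w → w ⊖ (s · conj w) ≡ ((1ℤ - s) * re w) + ((1ℤ ℤ.+ s) * im w) i
⊖-·conj s (p + q i) = cong₂ _+_i (re-identity s p) (im-identity s q)
  where
  re-identity : ∀ s p → p - s * p ≡ (1ℤ - s) * p
  re-identity = solve-∀
  im-identity : ∀ s q → q - s * - q ≡ (1ℤ ℤ.+ s) * q
  im-identity = solve-∀

+∣x∣*+∣x∣≡x*x : ∀ x → + ∣ x ∣ * + ∣ x ∣ ≡ x * x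
+∣x∣*+∣x∣≡x*x x with +∣i∣≡i⊎+∣i∣≡-i x
... | inj₁ eq = cong₂ _*_ eq eq
... | inj₂ eq = trans (cong₂ _*_ eq eq) (-x*-x≡x*x x)
  where
  -x*-x≡x*x : ∀ x → - x * - x ≡ x * x
  -x*-x≡x*x = solve-∀

+2∣x∣*+2∣x∣≡2x*2x : ∀ x → + (2 ℕ.* ∣ x ∣) * + (2 ℕ.* ∣ x ∣) ≡ (+ 2 * x) * (+ 2 * x)
+2∣x∣*+2∣x∣≡2x*2x x = begin
  + (2 ℕ.* ∣ x ∣) * + (2 ℕ.* ∣ x ∣)   ≡⟨ cong (λ n → + n * + n) (abs-* (+ 2) x) ⟨
  + ∣ + 2 * x ∣ * + ∣ + 2 * x ∣       ≡⟨ +∣x∣*+∣x∣≡x*x (+ 2 * x) ⟩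
  (+ 2 * x) * (+ 2 * x)               ∎
  where open ≡-Reasoning

IsHalfAbs-re : ∀ x → IsHalfAbs ((+ 2 * x) + (+ 0) i) ∣ x ∣
IsHalfAbs-re x = trans (+-identityʳ _) (sym (+2∣x∣*+2∣x∣≡2x*2x x))

IsHalfAbs-im : ∀ x → IsHalfAbs ((+ 0) + (+ 2 * x) i) ∣ x ∣
IsHalfAbs-im x = trans (+-identityˡ _) (sym (+2∣x∣*+2∣x∣≡2x*2x x))

sumZ≡ : ∀ Z → sumZ Z ≡ ((1ℤ ℤ.+ -1ℤ ^ Z) * re (β ^ᵍ Z)) + ((1ℤ - -1ℤ ^ Z) * im (β ^ᵍ Z)) i
sumZ≡ Z = trans (cong (β ^ᵍ Z ⊕_) (neg-conj-^ β Z)) (⊕-·conj (-1ℤ ^ Z) (β ^ᵍ Z))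

diffZ≡ : ∀ Z → diffZ Z ≡ ((1ℤ - -1ℤ ^ Z) * re (β ^ᵍ Z)) + ((1ℤ ℤ.+ -1ℤ ^ Z) * im (β ^ᵍ Z)) i
diffZ≡ Z = trans (cong ((β ^ᵍ Z) ⊖_) (neg-conj-^ β Z)) (⊖-·conj (-1ℤ ^ Z) (β ^ᵍ Z))

sumZ-even : ∀ {Z} → -1ℤ ^ Z ≡ 1ℤ → sumZ Z ≡ (+ 2 * re (β ^ᵍ Z)) + (+ 0) i
sumZ-even {Z} even rewrite sumZ≡ Z | even = refl

diffZ-even : ∀ {Z} → -1ℤ ^ Z ≡ 1ℤ → diffZ Z ≡ (+ 0) + (+ 2 * im (β ^ᵍ Z)) i
diffZ-even {Z} even rewrite diffZ≡ Z | even = refl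

sumZ-odd : ∀ {Z} → -1ℤ ^ Z ≡ -1ℤ → sumZ Z ≡ (+ 0) + (+ 2 * im (β ^ᵍ Z)) i
sumZ-odd {Z} odd rewrite sumZ≡ Z | odd = refl

diffZ-odd : ∀ {Z} → -1ℤ ^ Z ≡ -1ℤ → diffZ Z ≡ (+ 2 * re (β ^ᵍ Z)) + (+ 0) i
diffZ-odd {Z} odd rewrite diffZ≡ Z | odd = refl

IsHalfAbs-even : ∀ {Z} → -1ℤ ^ Z ≡ 1ℤ →
                 IsHalfAbs (sumZ Z) ∣ re (β ^ᵍ Z) ∣ × IsHalfAbs (diffZ Z) ∣ im (β ^ᵍ Z) ∣
IsHalfAbs-even {Z} even =
  subst (λ w → IsHalfAbs w ∣ re (β ^ᵍ Z) ∣) (sym (sumZ-even {Z} even)) (IsHalfAbs-re (re (β ^ᵍ Z))) ,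
  subst (λ w → IsHalfAbs w ∣ im (β ^ᵍ Z) ∣) (sym (diffZ-even {Z} even)) (IsHalfAbs-im (im (β ^ᵍ Z)))

IsHalfAbs-odd : ∀ {Z} → -1ℤ ^ Z ≡ -1ℤ →
                IsHalfAbs (sumZ Z) ∣ im (β ^ᵍ Z) ∣ × IsHalfAbs (diffZ Z) ∣ re (β ^ᵍ Z) ∣
IsHalfAbs-odd {Z} odd =
  subst (λ w → IsHalfAbs w ∣ im (β ^ᵍ Z) ∣) (sym (sumZ-odd {Z} odd)) (IsHalfAbs-im (im (β ^ᵍ Z))) ,
  subst (λ w → IsHalfAbs w ∣ re (β ^ᵍ Z) ∣) (sym (diffZ-odd {Z} odd)) (IsHalfAbs-re (re (β ^ᵍ Z)))

HalfAbsE₁₃ : ℕ → ℕ × ℕ → Set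
HalfAbsE₁₃ Z e = ∃₂ λ (a b : ℕ) →
  IsHalfAbs (sumZ Z) a × IsHalfAbs (diffZ Z) b ×
  Coprime a 13 × Coprime b 13 ×
  IsE 13 (+ a) (proj₁ e) × IsE 13 (+ b) (proj₂ e)

halfAbsE : ∀ {Z e x y} → IsHalfAbs (sumZ Z) ∣ x ∣ × IsHalfAbs (diffZ Z) ∣ y ∣ →
           IsE 13 x (proj₁ e) → IsE 13 y (proj₂ e) → HalfAbsE₁₃ Z e
halfAbsE {x = x} {y} (sum , diff) ex ey =
  ∣ x ∣ , ∣ y ∣ , sum , diff ,
  IsE⇒coprime {A = x} ex , IsE⇒coprime {A = y} ey , IsE-∣∣ {A = x} ex , IsE-∣∣ {A = y} ey

module _ {Z : ℕ} (Z₀ : ℕ) {e : ℕ × ℕ} (β^Z≡β^Z₀ : β ^ᵍ Z ≡ᵍ β ^ᵍ Z₀ [mod 13 ]) where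

  halfAbsE-even : -1ℤ ^ Z ≡ 1ℤ →
    IsE 13 (re (β ^ᵍ Z₀)) (proj₁ e) → IsE 13 (im (β ^ᵍ Z₀)) (proj₂ e) → HalfAbsE₁₃ Z e
  halfAbsE-even even ea eb =
    halfAbsE {Z} {e} (IsHalfAbs-even {Z} even) (IsE-resp (proj₁ β^Z≡β^Z₀) ea) (IsE-resp (proj₂ β^Z≡β^Z₀) eb)

  halfAbsE-odd : -1ℤ ^ Z ≡ -1ℤ →
    IsE 13 (im (β ^ᵍ Z₀)) (proj₁ e) → IsE 13 (re (β ^ᵍ Z₀)) (proj₂ e) → HalfAbsE₁₃ Z e
  halfAbsE-odd odd ea eb =
    halfAbsE {Z} {e} (IsHalfAbs-odd {Z} odd) (IsE-resp (proj₂ β^Z≡β^Z₀) ea) (IsE-resp (proj₁ β^Z≡β^Z₀) eb)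

halfAbsE-residue : ∀ {Z} r → r < 6 → -1ℤ ^ Z ≡ -1ℤ ^ suc r → β ^ᵍ Z ≡ᵍ β ^ᵍ suc r [mod 13 ] →
                   HalfAbsE₁₃ Z (expected (suc r % 6))
halfAbsE-residue {Z} 0 _ s β^Z≡ = halfAbsE-odd  {Z} 1 β^Z≡ s isE-by-computation isE-by-computation
halfAbsE-residue {Z} 1 _ s β^Z≡ = halfAbsE-even {Z} 2 β^Z≡ s isE-by-computation isE-by-computation
halfAbsE-residue {Z} 2 _ s β^Z≡ = halfAbsE-odd  {Z} 3 β^Z≡ s isE-by-computation isE-by-computation
halfAbsE-residue {Z} 3 _ s β^Z≡ = halfAbsE-even {Z} 4 β^Z≡ s isE-by-computation isE-by-computation
halfAbsE-residue {Z} 4 _ s β^Z≡ = halfAbsE-odd  {Z} 5 β^Z≡ s isE-by-computation isE-by-computation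
halfAbsE-residue {Z} 5 _ s β^Z≡ = halfAbsE-even {Z} 6 β^Z≡ s isE-by-computation isE-by-computation
halfAbsE-residue (suc (suc (suc (suc (suc (suc _)))))) (s≤s (s≤s (s≤s (s≤s (s≤s (s≤s ()))))))

-- β⁷ = 6554 + 4449i = β + 13 (504 + 342i).
β^7≡β : β ^ᵍ 7 ≡ᵍ β ^ᵍ 1 [mod 13 ]
β^7≡β = ≡mod (divides (+ 504) refl) , ≡mod (divides (+ 342) refl)

lemma9p1 : (Z : ℕ) → 0 < Z →
    ∃₂ λ (a b : ℕ) →
      IsHalfAbs (sumZ Z) a × IsHalfAbs (diffZ Z) b ×
      Coprime a 13 × Coprime b 13 ×
      IsE 13 (+ a) (proj₁ (expected (Z % 6))) ×
      IsE 13 (+ b) (proj₂ (expected (Z % 6)))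
lemma9p1 (suc n) _ = subst (HalfAbsE₁₃ (suc n) ∘ expected) (sym (suc-% n 6))
  (halfAbsE-residue {suc n} (n % 6) (m%n<n n 6) sign-periodic β-periodic)
  where
  sign-periodic : -1ℤ ^ suc n ≡ -1ℤ ^ suc (n % 6)
  sign-periodic = %-periodic _≡_ refl trans (λ m → -1ℤ ^ suc m) 5 (cong (-1ℤ *_)) refl n
  β-periodic : β ^ᵍ suc n ≡ᵍ β ^ᵍ suc (n % 6) [mod 13 ]
  β-periodic = %-periodic _≡ᵍ_[mod 13 ] ≡ᵍmod-refl ≡ᵍmod-trans (λ m → β ^ᵍ suc m) 5 (⊗-congˡ-mod β) β^7≡β n
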